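{- Let $\mathcal{R}_S \subseteq \mathcal{P}_S^2$ and $\mathcal{R}_T \subseteq \mathcal{P}_T^2$ be equivalences. If an encoding $[\![\cdot]\!] : \mathcal{P}_S \to \mathcal{P}_T$ is surjective ($\forall T .\ \exists S .\ T = [\![S]\!]$), fully abstract w.r.t. $\mathcal{R}_S$ and $\mathcal{R}_T$, and operationally corresponding w.r.t. $\mathcal{R}_T$, then $\mathcal{R}_S$ is a bisimulation iff $\mathcal{R}_T$ is a bisimulation.
   Context: Source $\langle \mathcal{P}_S, \longmapsto_S\rangle$, target $\langle \mathcal{P}_T, \longmapsto_T\rangle$, encoding $[\![\cdot]\!]$; $\longmapsto^{*}$ is the reflexive transitive closure of $\longmapsto$. Full abstraction: for all $S_1,S_2$, $(S_1,S_2)\in\mathcal{R}_S$ iff $([\![S_1]\!],[\![S_2]\!])\in\mathcal{R}_T$. Operational correspondence w.r.t. $\mathcal{R}_T$: $S\longmapsto_S^{*}S'$ implies $\exists T.\ [\![S]\!]\longmapsto_T^{*}T\wedge([\![S']\!],T)\in\mathcal{R}_T$, and $[\![S]\!]\longmapsto_T^{*}T$ implies $\exists S'.\ S\longmapsto_S^{*}S'\wedge([\![S']\!],T)\in\mathcal{R}_T$. Bisimulation: for $(P,Q)\in\mathcal{R}$, $P\longmapsto^{*}P'$ implies $\exists Q'.\ Q\longmapsto^{*}Q'\wedge(P',Q')\in\mathcal{R}$, and $Q\longmapsto^{*}Q'$ implies $\exists P'.\ P\longmapsto^{*}P'\wedge(P',Q')\in\mathcal{R}$. -}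

module Defs where

open import Data.Product using (Σ; ∃; _×_; _,_)
open import Relation.Binary.Core using (Rel)
open import Relation.Binary.Structures using (IsEquivalence)
open import Relation.Binary.Construct.Closure.ReflexiveTransitive using (Star)
open import Relation.Binary.PropositionalEquality using (_≡_)

record Calculus : Set₁ where
  field
    Proc : Set
    _⟼_  : Rel Proc _

open Calculus public

_⟼*_ : (C : Calculus) → Rel (Proc C) _
_⟼*_ C = Star (_⟼_ C)

IsBisimulation : (C : Calculus) → Rel (Proc C) _ → Set
IsBisimulation C R =
  ∀ P Q → R P Q →
    (∀ P' → (_⟼*_ C) P P' → Σ (Proc C) λ Q' → (_⟼*_ C) Q Q' × R P' Q')
  × (∀ Q' → (_⟼*_ C) Q Q' → Σ (Proc C) λ P' → (_⟼*_ C) P P' × R P' Q')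

module _ (S T : Calculus) (enc : Proc S → Proc T) where

  Surjective : Set
  Surjective = ∀ (t : Proc T) → Σ (Proc S) λ s → t ≡ enc s

  FullyAbstract : Rel (Proc S) _ → Rel (Proc T) _ → Set
  FullyAbstract RS RT =
    ∀ S₁ S₂ → (RS S₁ S₂ → RT (enc S₁) (enc S₂)) × (RT (enc S₁) (enc S₂) → RS S₁ S₂)

  OperationalCorrespondence : Rel (Proc T) _ → Set
  OperationalCorrespondence RT =
    (∀ s s' → (_⟼*_ S) s s' → Σ (Proc T) λ t → (_⟼*_ T) (enc s) t × RT (enc s') t)
    × (∀ s t → (_⟼*_ T) (enc s) t → Σ (Proc S) λ s' → (_⟼*_ S) s s' × RT (enc s') t)

module Submission where

-- A simulation step on one side is transported to the other: operational
-- correspondence moves the reduction across the encoding, full abstraction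
-- moves the relation, and transitivity of R_T absorbs the R_T-slack that
-- operational correspondence introduces at both ends.  Surjectivity is what
-- lets every target process be treated as an encoded one.  Since both
-- relations are symmetric, one half of the bisimulation game suffices.

open import Defs
open import Data.Product using (Σ; _×_; _,_; proj₁; proj₂)
open import Relation.Binary.Core using (Rel)
open import Relation.Binary.Definitions using (Symmetric; Transitive)
open import Relation.Binary.Structures using (IsEquivalence)
open import Relation.Binary.PropositionalEquality using (refl)

IsSimulation : (C : Calculus) → Rel (Proc C) _ → Set
IsSimulation C R =
  ∀ P Q → R P Q →
    ∀ P' → (_⟼*_ C) P P' → Σ (Proc C) λ Q' → (_⟼*_ C) Q Q' × R P' Q'

bisimulation⇒simulation : (C : Calculus) {R : Rel (Proc C) _} →
                          IsBisimulation C R → IsSimulation C R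
bisimulation⇒simulation C bisim P Q r = proj₁ (bisim P Q r)

symmetric-simulation⇒bisimulation : (C : Calculus) {R : Rel (Proc C) _} →
  Symmetric R → IsSimulation C R → IsBisimulation C R
symmetric-simulation⇒bisimulation C {R} sym sim P Q r = sim P Q r , answer
  where
  answer : ∀ Q' → (_⟼*_ C) Q Q' → Σ (Proc C) λ P' → (_⟼*_ C) P P' × R P' Q'
  answer Q' Q⟼*Q' with sim Q P (sym r) Q' Q⟼*Q'
  ... | P' , P⟼*P' , r' = P' , P⟼*P' , sym r'

module _ (S T : Calculus) (enc : Proc S → Proc T)
         {RS : Rel (Proc S) _} {RT : Rel (Proc T) _}
         (symT : Symmetric RT) (transT : Transitive RT)
         (fa : FullyAbstract S T enc RS RT)
         (oc : OperationalCorrespondence S T enc RT) where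

  private
    sound : ∀ s s' → (_⟼*_ S) s s' → Σ (Proc T) λ t → (_⟼*_ T) (enc s) t × RT (enc s') t
    sound = proj₁ oc

    complete : ∀ s t → (_⟼*_ T) (enc s) t → Σ (Proc S) λ s' → (_⟼*_ S) s s' × RT (enc s') t
    complete = proj₂ oc

    preserve : ∀ s₁ s₂ → RS s₁ s₂ → RT (enc s₁) (enc s₂)
    preserve s₁ s₂ = proj₁ (fa s₁ s₂)

    reflect : ∀ s₁ s₂ → RT (enc s₁) (enc s₂) → RS s₁ s₂
    reflect s₁ s₂ = proj₂ (fa s₁ s₂)

  source-simulation⇒target-simulation :
    Surjective S T enc → IsSimulation S RS → IsSimulation T RT
  source-simulation⇒target-simulation surj sim P Q r P' P⟼*P'
    with surj P | surj Q
  ... | s₁ , refl | s₂ , refl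
    with complete s₁ P' P⟼*P'
  ... | s₁' , s₁⟼*s₁' , ⟦s₁'⟧~P'
    with sim s₁ s₂ (reflect s₁ s₂ r) s₁' s₁⟼*s₁'
  ... | s₂' , s₂⟼*s₂' , s₁'~s₂'
    with sound s₂ s₂' s₂⟼*s₂'
  ... | Q' , ⟦s₂⟧⟼*Q' , ⟦s₂'⟧~Q' =
    Q' , ⟦s₂⟧⟼*Q' ,
    transT (symT ⟦s₁'⟧~P') (transT (preserve s₁' s₂' s₁'~s₂') ⟦s₂'⟧~Q')

  target-simulation⇒source-simulation :
    IsSimulation T RT → IsSimulation S RS
  target-simulation⇒source-simulation sim s₁ s₂ r s₁' s₁⟼*s₁'
    with sound s₁ s₁' s₁⟼*s₁'
  ... | P' , ⟦s₁⟧⟼*P' , ⟦s₁'⟧~P'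
    with sim (enc s₁) (enc s₂) (preserve s₁ s₂ r) P' ⟦s₁⟧⟼*P'
  ... | Q' , ⟦s₂⟧⟼*Q' , P'~Q'
    with complete s₂ Q' ⟦s₂⟧⟼*Q'
  ... | s₂' , s₂⟼*s₂' , ⟦s₂'⟧~Q' =
    s₂' , s₂⟼*s₂' ,
    reflect s₁' s₂' (transT ⟦s₁'⟧~P' (transT P'~Q' (symT ⟦s₂'⟧~Q')))

lemma17 : (S T : Calculus) (enc : Proc S → Proc T)
    (RS : Rel (Proc S) _) (RT : Rel (Proc T) _) →
    IsEquivalence RS → IsEquivalence RT →
    Surjective S T enc →
    FullyAbstract S T enc RS RT →
    OperationalCorrespondence S T enc RT →
    (IsBisimulation S RS → IsBisimulation T RT) × (IsBisimulation T RT → IsBisimulation S RS)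
lemma17 S T enc RS RT eqS eqT surj fa oc =
    (λ bisimS → symmetric-simulation⇒bisimulation T ET.sym
                  (source-simulation⇒target-simulation S T enc ET.sym ET.trans fa oc surj
                    (bisimulation⇒simulation S bisimS)))
  , (λ bisimT → symmetric-simulation⇒bisimulation S ES.sym
                  (target-simulation⇒source-simulation S T enc ET.sym ET.trans fa oc
                    (bisimulation⇒simulation T bisimT)))
  where
  module ES = IsEquivalence eqS
  module ET = IsEquivalence eqT
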